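{- Suppose that the following statement (*) holds: for all integers $n,r,s \geq 2$ with $r \geq s$ and every hypergraph $\mathcal{G}$ with vertex set $[n]$, $\chi\left(\mathrm{KG}^r(\mathcal{G}_{\widetilde{s\text{ -stable}}})\right) \geq \left\lceil \frac{\mathrm{cd}^r(\mathcal{G})}{r-1} \right\rceil$. Then for all integers $n,r,s \geq 2$ with $r \geq s$ and every hypergraph $\mathcal{G}$ with vertex set $[n]$, $$\left\lceil \frac{\mathrm{cd}^r(\mathcal{G})}{r-1} \right\rceil - \chi\left(\mathrm{KG}^r(\mathcal{G}_{s\text{ -stable}})\right) \leq 1;$$ in particular, this difference cannot be arbitrarily large.
   Context: $[n]=\{1,\dots,n\}$. A hypergraph $\mathcal{H}$ on vertex set $V$ is a family $E(\mathcal{H})$ of nonempty subsets of $V$ (hyperedges). A set $S \subseteq [n]$ is $s$-stable if any two distinct $i,j \in S$ satisfy $s \leq |i-j| \leq n-s$, and almost $s$-stable if any two distinct $i,j\in S$ satisfy $|i-j| \geq s$. For a hypergraph $\mathcal{G}$ on $[n]$, $\mathcal{G}_{s\text{ -stable}}$ (resp. $\mathcal{G}_{\widetilde{s\text{ -stable}}}$) denotes the hypergraph on $[n]$ whose hyperedges are the $s$-stable (resp. almost $s$-stable) hyperedges of $\mathcal{G}$. For a hypergraph $\mathcal{F}$ and $r\ge 2$, the general Kneser hypergraph $\mathrm{KG}^r(\mathcal{F})$ has vertex set $E(\mathcal{F})$, and its hyperedges are the sets of $r$ pairwise disjoint hyperedges of $\mathcal{F}$. The chromatic number $\chi$ of a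 hypergraph is the least number of colors in a vertex coloring with no monochromatic hyperedge (it is $0$ when the vertex set is empty). The $r$-colorability defect $\mathrm{cd}^r(\mathcal{H})$ is the minimum size of a set $S \subseteq V(\mathcal{H})$ such that the induced subhypergraph on $V(\mathcal{H})\setminus S$ (whose hyperedges are the hyperedges of $\mathcal{H}$ contained in $V(\mathcal{H})\setminus S$) admits a vertex coloring with at most $r$ colors having no monochromatic hyperedge. -}

module Defs where

open import Data.Nat using (ℕ; zero; suc; _≤_; _∸_; _+_; _/_; ∣_-_∣)
open import Data.Fin using (Fin; toℕ)
open import Data.Fin.Subset using (Subset; _∈_; _∩_; ∁; _⊆_; Nonempty; Empty; ∣_∣)
open import Data.Product using (Σ; _×_; ∃)
open import Relation.Binary.PropositionalEquality using (_≡_; _≢_)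

record Hypergraph (n : ℕ) : Set₁ where
  field
    Edge     : Subset n → Set
    nonempty : ∀ E → Edge E → Nonempty E
open Hypergraph public

-- s-stable: s ≤ |i-j| ≤ n-s for distinct i, j ∈ S
-- (vertices 0..n-1 instead of 1..n; differences are unchanged)
Stable : (n s : ℕ) → Subset n → Set
Stable n s S = ∀ i j → i ∈ S → j ∈ S → i ≢ j →
  (s ≤ ∣ toℕ i - toℕ j ∣) × (∣ toℕ i - toℕ j ∣ ≤ n ∸ s)

AlmostStable : (n s : ℕ) → Subset n → Set
AlmostStable n s S = ∀ i j → i ∈ S → j ∈ S → i ≢ j → s ≤ ∣ toℕ i - toℕ j ∣

stablePart : ∀ {n} → ℕ → Hypergraph n → Hypergraph n
stablePart {n} s G = record
  { Edge = λ E → Edge G E × Stable n s E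
  ; nonempty = λ E p → nonempty G E (Data.Product.proj₁ p) }

almostStablePart : ∀ {n} → ℕ → Hypergraph n → Hypergraph n
almostStablePart {n} s G = record
  { Edge = λ E → Edge G E × AlmostStable n s E
  ; nonempty = λ E p → nonempty G E (Data.Product.proj₁ p) }

-- A coloring with k colors of the vertices of KG^r(F) (vertices = edges of F)
KGColoring : ∀ {n} → ℕ → Hypergraph n → Set
KGColoring {n} k F = (E : Subset n) → Edge F E → Fin k

-- proper: no hyperedge of KG^r(F) (r pairwise disjoint edges of F) is monochromatic
ProperKGColoring : ∀ {n} (r k : ℕ) (F : Hypergraph n) → KGColoring k F → Set
ProperKGColoring {n} r k F c =
  (es : Fin r → Subset n) (ok : ∀ i → Edge F (es i)) →
  (∀ i j → i ≢ j → Empty (es i ∩ es j)) →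
  ¬ (∀ i j → c (es i) (ok i) ≡ c (es j) (ok j))
  where open import Relation.Nullary using (¬_)

IsChromaticNumberKG : ∀ {n} (r : ℕ) (F : Hypergraph n) → ℕ → Set
IsChromaticNumberKG r F m =
  (Σ (KGColoring m F) (ProperKGColoring r m F)) ×
  (∀ k (c : KGColoring k F) → ProperKGColoring r k F c → m ≤ k)

ColorableOutside : ∀ {n} (r : ℕ) (G : Hypergraph n) → Subset n → Set
ColorableOutside {n} r G S =
  Σ (Fin n → Fin r) λ c → ∀ E → Edge G E → E ⊆ ∁ S →
    ¬ (∀ x y → x ∈ E → y ∈ E → c x ≡ c y)
  where open import Relation.Nullary using (¬_)

IsColorabilityDefect : ∀ {n} (r : ℕ) (G : Hypergraph n) → ℕ → Set
IsColorabilityDefect {n} r G d =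
  (Σ (Subset n) λ S → (∣ S ∣ ≡ d) × ColorableOutside r G S) ×
  (∀ S → ColorableOutside r G S → d ≤ ∣ S ∣)

-- ⌈ d / m ⌉ (m > 0; value at m = 0 irrelevant)
ceilDiv : ℕ → ℕ → ℕ
ceilDiv d zero = zero
ceilDiv d (suc k) = (d + k) / suc k

{-# OPTIONS --safe #-}
module Submission where

-- Keep the colouring of KG^r(G_{s-stable}) on the stable edges and give every
-- almost s-stable but not s-stable edge one new colour. Such an edge has two
-- elements i < j with j - i > n - s, and j < n forces i < s - 1; so r pairwise
-- disjoint edges of the new colour would need r distinct elements of the
-- (s-1)-set {0, …, s-2}, impossible as r ≥ s. Hence
-- χ(KG^r(G_{almost s-stable})) ≤ χ(KG^r(G_{s-stable})) + 1, and (*) finishes.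

open import Defs
open import Data.Nat using (ℕ; suc; _≤_; _<_; _∸_; _≤?_; _<?_; z<s; ∣_-_∣)
open import Data.Nat.Properties
  using (≤-total; ≤-trans; ≤-reflexive; <-trans; <⇒≱; ≰⇒>; ≮⇒≥; ∸-monoˡ-≤; ∸-monoʳ-≤;
         m≤n⇒∣m-n∣≡n∸m; ∣-∣-comm; m+n∸n≡m; module ≤-Reasoning)
open import Data.Nat.Induction using (<-rec)
open import Data.Fin using (Fin; zero; toℕ; fromℕ; fromℕ<; inject₁; _≟_)
open import Data.Fin.Properties
  using (all?; any?; pigeonhole; <⇒≢; toℕ<n; toℕ-injective; fromℕ<-injective;
         fromℕ≢inject₁; inject₁-injective)
open import Data.Fin.Subset using (Subset; _∈_; _∩_; Empty)
open import Data.Fin.Subset.Properties using (_∈?_; x∈p∩q⁺)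
open import Data.Product using (Σ; ∃; _×_; _,_; proj₁; proj₂)
open import Data.Sum using (_⊎_; inj₁; inj₂; [_,_]′)
open import Relation.Nullary using (¬_; Dec; yes; no; ¬?; contradiction)
open import Relation.Nullary.Decidable using (_×-dec_; _→-dec_; map′; decidable-stable)
open import Relation.Binary.PropositionalEquality using (_≡_; _≢_; refl; sym; trans; subst)

PairwiseDisjoint : ∀ {n r} → (Fin r → Subset n) → Set
PairwiseDisjoint es = ∀ i j → i ≢ j → Empty (es i ∩ es j)

KGColorable : ∀ {n} (r k : ℕ) → Hypergraph n → Set
KGColorable r k F = Σ (KGColoring k F) (ProperKGColoring r k F)

stable? : ∀ n s (E : Subset n) → Dec (Stable n s E)
stable? n s E = all? λ i → all? λ j →
  (i ∈? E) →-dec (j ∈? E) →-dec ¬? (i ≟ j) →-dec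
  (s ≤? ∣ toℕ i - toℕ j ∣) ×-dec (∣ toℕ i - toℕ j ∣ ≤? n ∸ s)

gap>∸⇒suc< : ∀ {a b n s} → a ≤ b → b < n → n ∸ s < b ∸ a → suc a < s
gap>∸⇒suc< {a} {b} {n} {s} a≤b b<n gap = ≰⇒> λ s≤1+a → <⇒≱ gap (begin
  b ∸ a      ≤⟨ ∸-monoˡ-≤ (suc a) b<n ⟩
  n ∸ suc a  ≤⟨ ∸-monoʳ-≤ n s≤1+a ⟩
  n ∸ s      ∎)
  where open ≤-Reasoning

∣-∣>∸⇒suc< : ∀ {a b n s} → a < n → b < n → n ∸ s < ∣ a - b ∣ → suc a < s ⊎ suc b < s
∣-∣>∸⇒suc< {a} {b} {n} {s} a<n b<n far with ≤-total a b
... | inj₁ a≤b = inj₁ (gap>∸⇒suc< a≤b b<n (subst (n ∸ s <_) (m≤n⇒∣m-n∣≡n∸m a≤b) far))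
... | inj₂ b≤a = inj₂ (gap>∸⇒suc< b≤a a<n
  (subst (n ∸ s <_) (trans (∣-∣-comm a b) (m≤n⇒∣m-n∣≡n∸m b≤a)) far))

almostStable⇒stable : ∀ {n s} {E : Subset n} → AlmostStable n s E →
  (∀ x → x ∈ E → s ≤ suc (toℕ x)) → Stable n s E
almostStable⇒stable almost large i j i∈E j∈E i≢j =
  almost i j i∈E j∈E i≢j , ≮⇒≥ λ far →
    [ (λ i-small → <⇒≱ i-small (large i i∈E)) , (λ j-small → <⇒≱ j-small (large j j∈E)) ]′
      (∣-∣>∸⇒suc< (toℕ<n i) (toℕ<n j) far)

almostStable∧¬stable⇒small : ∀ {n s} {E : Subset n} → AlmostStable n s E → ¬ Stable n s E →
  ∃ λ x → x ∈ E × toℕ x < s ∸ 1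
almostStable∧¬stable⇒small {s = s} {E} almost unstable =
  decidable-stable (any? λ x → (x ∈? E) ×-dec (toℕ x <? s ∸ 1)) λ noSmall →
    unstable (almostStable⇒stable almost λ x x∈E → ≮⇒≥ λ x-small →
      noSmall (x , x∈E , ∸-monoˡ-≤ 1 x-small))

¬pairwiseDisjoint-meeting-< : ∀ {n m r} → m < r → (es : Fin r → Subset n) →
  (point : Fin r → Fin n) → (∀ i → point i ∈ es i) → (∀ i → toℕ (point i) < m) →
  ¬ PairwiseDisjoint es
¬pairwiseDisjoint-meeting-< m<r es point point∈ point<m disjoint
  with i , j , i<j , samePosition ← pigeonhole m<r (λ i → fromℕ< (point<m i)) =
  disjoint i j (<⇒≢ i<j) (point i , x∈p∩q⁺ (point∈ i , subst (_∈ es j) (sym samePoint) (point∈ j)))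
  where
  samePoint : point i ≡ point j
  samePoint = toℕ-injective (fromℕ<-injective _ _ (point<m i) (point<m j) samePosition)

module OneNewColour {n k} {F H : Hypergraph n}
  (inF? : ∀ E → Edge H E → Dec (Edge F E)) (c : KGColoring k F) where

  extend : KGColoring (suc k) H
  extend E h with inF? E h
  ... | yes e = inject₁ (c E e)
  ... | no _  = fromℕ k

  extend-new : ∀ E h → extend E h ≡ fromℕ k → ¬ Edge F E
  extend-new E h new with inF? E h
  ... | yes e = contradiction (sym new) fromℕ≢inject₁
  ... | no ¬e = ¬e

  extend-old : ∀ E h → extend E h ≢ fromℕ k → Σ (Edge F E) λ e → extend E h ≡ inject₁ (c E e)
  extend-old E h old with inF? E h
  ... | yes e = e , refl
  ... | no _  = contradiction refl old

  extend-proper : ∀ {r} → ProperKGColoring r k F c →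
    (∀ (es : Fin r → Subset n) → (∀ i → Edge H (es i)) → (∀ i → ¬ Edge F (es i)) →
      ¬ PairwiseDisjoint es) →
    ProperKGColoring r (suc k) H extend
  extend-proper {0} proper _ es _ _ _ = proper es (λ ()) (λ ()) (λ ())
  extend-proper {suc r} proper newSparse es hs disjoint same
    with extend (es zero) (hs zero) ≟ fromℕ k
  ... | yes new₀ =
    newSparse es hs (λ i → extend-new (es i) (hs i) (trans (same i zero) new₀)) disjoint
  ... | no old₀ = proper es (λ i → proj₁ (old i)) disjoint λ i j →
    inject₁-injective (trans (sym (proj₂ (old i))) (trans (same i j) (proj₂ (old j))))
    where
    old : ∀ i → Σ (Edge F (es i)) λ e → extend (es i) (hs i) ≡ inject₁ (c (es i) e)
    old i = extend-old (es i) (hs i) λ new → old₀ (trans (same zero i) new)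

¬pairwiseDisjoint-unstable : ∀ {n r s} (G : Hypergraph n) → s ∸ 1 < r →
  (es : Fin r → Subset n) → (∀ i → Edge (almostStablePart s G) (es i)) →
  (∀ i → ¬ Edge (stablePart s G) (es i)) → ¬ PairwiseDisjoint es
¬pairwiseDisjoint-unstable {s = s} G s∸1<r es hs unstable =
  ¬pairwiseDisjoint-meeting-< s∸1<r es (λ i → proj₁ (small i))
    (λ i → proj₁ (proj₂ (small i))) (λ i → proj₂ (proj₂ (small i)))
  where
  small : ∀ i → ∃ λ x → x ∈ es i × toℕ x < s ∸ 1
  small i = almostStable∧¬stable⇒small (proj₂ (hs i)) λ stable → unstable i (proj₁ (hs i) , stable)

almostStablePart-colorable : ∀ {n r s k} (G : Hypergraph n) → 0 < s → s ≤ r →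
  KGColorable r k (stablePart s G) → KGColorable r (suc k) (almostStablePart s G)
almostStablePart-colorable {n} {s = suc s} G _ s<r (c , proper) =
  extend , extend-proper proper (¬pairwiseDisjoint-unstable G s<r)
  where
  open OneNewColour {F = stablePart (suc s) G} {H = almostStablePart (suc s) G}
    (λ E h → map′ (proj₁ h ,_) proj₂ (stable? n (suc s) E)) c

¬¬-minimal : ∀ (P : ℕ → Set) {m} → P m → ¬ ¬ (∃ λ m′ → P m′ × (∀ k → P k → m′ ≤ k))
¬¬-minimal P {m} = <-rec (λ m → P m → ¬ ¬ (∃ λ m′ → P m′ × (∀ k → P k → m′ ≤ k))) step m
  where
  step : ∀ m → (∀ {k} → k < m → P k → ¬ ¬ (∃ λ m′ → P m′ × (∀ k → P k → m′ ≤ k))) →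
    P m → ¬ ¬ (∃ λ m′ → P m′ × (∀ k → P k → m′ ≤ k))
  step m below Pm noMinimum =
    noMinimum (m , Pm , λ k Pk → decidable-stable (m ≤? k) λ m≰k → below (≰⇒> m≰k) Pk noMinimum)

-- Without a decision procedure for proper colourings the chromatic number exists only
-- up to double negation, which suffices for the decidable goal of the theorem.
¬¬-chromaticNumber≤ : ∀ {n r k} {F : Hypergraph n} → KGColorable r k F →
  ¬ ¬ (∃ λ χ → IsChromaticNumberKG r F χ × χ ≤ k)
¬¬-chromaticNumber≤ {r = r} {F = F} colorable noχ =
  ¬¬-minimal (λ k → KGColorable r k F) colorable λ (χ , χ-colorable , minimal) →
    noχ (χ , (χ-colorable , λ k c proper → minimal k (c , proper)) , minimal _ colorable)

theorem1p13 : (∀ (n r s : ℕ) → 2 ≤ n → 2 ≤ r → 2 ≤ s → s ≤ r →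
    (G : Hypergraph n) (cd χ : ℕ) →
    IsColorabilityDefect r G cd →
    IsChromaticNumberKG r (almostStablePart s G) χ →
    ceilDiv cd (r ∸ 1) ≤ χ) →
    ∀ (n r s : ℕ) → 2 ≤ n → 2 ≤ r → 2 ≤ s → s ≤ r →
    (G : Hypergraph n) (cd χ : ℕ) →
    IsColorabilityDefect r G cd →
    IsChromaticNumberKG r (stablePart s G) χ →
    ceilDiv cd (r ∸ 1) ∸ χ ≤ 1
theorem1p13 almostStableBound n r s 2≤n 2≤r 2≤s s≤r G cd χ isCd (colorable , _) =
  ≤-trans (∸-monoˡ-≤ χ ceil≤1+χ) (≤-reflexive (m+n∸n≡m 1 χ))
  where
  ceil≤1+χ : ceilDiv cd (r ∸ 1) ≤ suc χ
  ceil≤1+χ = decidable-stable (_ ≤? suc χ) λ ceil≰1+χ →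
    ¬¬-chromaticNumber≤ {F = almostStablePart s G} (almostStablePart-colorable G (<-trans z<s 2≤s) s≤r colorable)
      λ (χ̃ , isχ̃ , χ̃≤1+χ) →
        ceil≰1+χ (≤-trans (almostStableBound n r s 2≤n 2≤r 2≤s s≤r G cd χ̃ isCd isχ̃) χ̃≤1+χ)
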